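{- The intruder model $\mathcal I_{\mathrm{symm}}=(\Sigma_{\mathrm{symm}},\vdash)$ is absorbing: for all lists $\vec x$ and $\vec y$ of pairwise distinct names, every finite set of messages $\Gamma$ with $\mathrm{names}(\Gamma)\cap\vec y=\emptyset$, setting $\Gamma'=\Gamma\{\vec x\mapsto\vec y\}$, and every message $M$ with $\mathrm{names}(M)\subseteq\mathrm{names}(\Gamma)$, we have $\Gamma\cup\Gamma'\vdash M$ if and only if $\Gamma\vdash M$.
   Context: Fix a countably infinite set of names. Messages are terms built from names using constructors; $\mathrm{names}(M)$ denotes the names occurring in $M$ (extended to sets); $\Gamma\{\vec x\mapsto\vec y\}$ denotes the set obtained by replacing each $x_i$ with $y_i$ in every message of $\Gamma$; $\Gamma,M$ denotes $\Gamma\cup\{M\}$. The signature $\Sigma_{\mathrm{symm}}$ consists of the binary constructors $(M,N)$ (pairing), $\{M\}_N$ (symmetric encryption), $\{\!|M|\!\}_N$ (asymmetric encryption) and the unary constructor $\mathrm{pub}(K)$. The relation $\vdash$ (between finite sets of messages and messages) is the smallest relation closed under the rules: (Id) if $M\in\Gamma$ then $\Gamma\vdash M$; (Pub) from $\Gamma\vdash K$ infer $\Gamma\vdash\mathrm{pub}(K)$; (P$_L$) from $\Gamma,(M,N),M,N\vdash M'$ infer $\Gamma,(M,N)\vdash M'$; (P$_R$) from $\Gamma\vdash M$ and $\Gamma\vdash N$ infer $\Gamma\vdash(M,N)$; (S$_L$) from $\Gamma,\{M\}_K\vdash K$ and $\Gamma,\{M\}_K,M,K\vdash N$ infer $\Gamma,\{M\}_K\vdash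 N$; (S$_R$) from $\Gamma\vdash M$ and $\Gamma\vdash K$ infer $\Gamma\vdash\{M\}_K$; (A$_L$) from $\Gamma,\{\!|M|\!\}_{\mathrm{pub}(K)}\vdash K$ and $\Gamma,\{\!|M|\!\}_{\mathrm{pub}(K)},M,K\vdash N$ infer $\Gamma,\{\!|M|\!\}_{\mathrm{pub}(K)}\vdash N$; (A$_R$) from $\Gamma\vdash M$ and $\Gamma\vdash N$ infer $\Gamma\vdash\{\!|M|\!\}_N$. -}

module Defs where

open import Data.Nat using (ℕ; _≟_)
open import Data.List using (List; []; _∷_; _++_; map; concatMap)
open import Data.List.Membership.Propositional using (_∈_)
open import Relation.Nullary using (yes; no)

Name : Set
Name = ℕ

data Msg : Set where
  nm   : Name → Msg
  pair : Msg → Msg → Msg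
  senc : Msg → Msg → Msg
  aenc : Msg → Msg → Msg
  pub  : Msg → Msg

names : Msg → List Name
names (nm a)     = a ∷ []
names (pair M N) = names M ++ names N
names (senc M N) = names M ++ names N
names (aenc M N) = names M ++ names N
names (pub K)    = names K

namesSet : List Msg → List Name
namesSet = concatMap names

-- The replacement {x⃗ ↦ y⃗} on a single name, given as a list of pairs (xᵢ , yᵢ).
-- (The xᵢ are pairwise distinct, so the first match is the only match.)
data Pair (A : Set) : Set where
  _↦_ : A → A → Pair A

renName : List (Pair Name) → Name → Name
renName []             a = a
renName ((x ↦ y) ∷ σ)  a with x ≟ a
... | yes _ = y
... | no  _ = renName σ a

renMsg : List (Pair Name) → Msg → Msg
renMsg σ (nm a)     = nm (renName σ a)
renMsg σ (pair M N) = pair (renMsg σ M) (renMsg σ N)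
renMsg σ (senc M N) = senc (renMsg σ M) (renMsg σ N)
renMsg σ (aenc M N) = aenc (renMsg σ M) (renMsg σ N)
renMsg σ (pub K)    = pub (renMsg σ K)

renSet : List (Pair Name) → List Msg → List Msg
renSet σ = map (renMsg σ)

-- A finite set of messages is represented
-- by a list; "Γ, M" is M ∷ Γ, and a left rule whose conclusion is
-- "Γ, C ⊢ N" is stated for any list containing C (C ∈ Γ), which is exactly
-- the set reading (Γ ∪ {C} with C possibly already in Γ).
infix 4 _⊢_
data _⊢_ (Γ : List Msg) : Msg → Set where
  Id  : ∀ {M} → M ∈ Γ → Γ ⊢ M
  Pub : ∀ {K} → Γ ⊢ K → Γ ⊢ pub K
  PL  : ∀ {M N M′} → pair M N ∈ Γ → (M ∷ N ∷ Γ) ⊢ M′ → Γ ⊢ M′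
  PR  : ∀ {M N} → Γ ⊢ M → Γ ⊢ N → Γ ⊢ pair M N
  SL  : ∀ {M K N} → senc M K ∈ Γ → Γ ⊢ K → (M ∷ K ∷ Γ) ⊢ N → Γ ⊢ N
  SR  : ∀ {M K} → Γ ⊢ M → Γ ⊢ K → Γ ⊢ senc M K
  AL  : ∀ {M K N} → aenc M (pub K) ∈ Γ → Γ ⊢ K → (M ∷ K ∷ Γ) ⊢ N → Γ ⊢ N
  AR  : ∀ {M N} → Γ ⊢ M → Γ ⊢ N → Γ ⊢ aenc M N

-- Deducibility is stable under weakening and under arbitrary renamings of
-- names.  Undoing the replacement, i.e. applying {y⃗ ↦ x⃗}, fixes Γ and M
-- (their names avoid y⃗) and sends Γ{x⃗ ↦ y⃗} back onto Γ, so it maps a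
-- derivation of Γ ∪ Γ′ ⊢ M to one of Γ ⊢ M; the converse is weakening.
module Submission where

open import Defs
open import Data.Nat using (ℕ; _≟_)
open import Data.Vec using (Vec; toList; zipWith; []; _∷_)
open import Data.Vec.Membership.Propositional.Properties using (∈-toList⁻)
open import Data.Vec.Relation.Unary.All as All using ()
open import Data.Vec.Relation.Unary.AllPairs using (_∷_)
open import Data.Vec.Relation.Unary.Unique.Propositional using (Unique)
open import Data.List using (List; _++_; map)
open import Data.List.Membership.Propositional using (_∈_; _∉_; lose)
open import Data.List.Membership.Propositional.Properties
  using (∈-++⁺ˡ; ∈-++⁺ʳ; ∈-++⁻; ∈-map⁺; ∈-map⁻; ∈-concatMap⁺)
open import Data.List.Relation.Binary.Subset.Propositional using (_⊆_)
open import Data.List.Relation.Binary.Subset.Propositional.Properties using (∷⁺ʳ; xs⊆xs++ys)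
open import Data.List.Relation.Unary.Any using (here; there)
open import Data.Product using (_,_)
open import Data.Sum using (_⊎_; inj₁; inj₂)
open import Data.Empty using (⊥-elim)
open import Relation.Nullary using (yes; no)
open import Relation.Binary.PropositionalEquality
  using (_≡_; refl; sym; trans; cong; cong₂; subst; module ≡-Reasoning)
open import Function.Bundles using (_⇔_; mk⇔)

rename : (Name → Name) → Msg → Msg
rename f (nm a)     = nm (f a)
rename f (pair M N) = pair (rename f M) (rename f N)
rename f (senc M N) = senc (rename f M) (rename f N)
rename f (aenc M N) = aenc (rename f M) (rename f N)
rename f (pub K)    = pub (rename f K)

renMsg≡rename : ∀ σ M → renMsg σ M ≡ rename (renName σ) M
renMsg≡rename σ (nm a)     = refl
renMsg≡rename σ (pair M N) = cong₂ pair (renMsg≡rename σ M) (renMsg≡rename σ N)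
renMsg≡rename σ (senc M N) = cong₂ senc (renMsg≡rename σ M) (renMsg≡rename σ N)
renMsg≡rename σ (aenc M N) = cong₂ aenc (renMsg≡rename σ M) (renMsg≡rename σ N)
renMsg≡rename σ (pub K)    = cong pub (renMsg≡rename σ K)

rename-∘ : ∀ f g M → rename f (rename g M) ≡ rename (λ a → f (g a)) M
rename-∘ f g (nm a)     = refl
rename-∘ f g (pair M N) = cong₂ pair (rename-∘ f g M) (rename-∘ f g N)
rename-∘ f g (senc M N) = cong₂ senc (rename-∘ f g M) (rename-∘ f g N)
rename-∘ f g (aenc M N) = cong₂ aenc (rename-∘ f g M) (rename-∘ f g N)
rename-∘ f g (pub K)    = cong pub (rename-∘ f g K)

rename-id-on-names : ∀ f M → (∀ {a} → a ∈ names M → f a ≡ a) → rename f M ≡ M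
rename-id-on-names f (nm a)     fix = cong nm (fix (here refl))
rename-id-on-names f (pair M N) fix =
  cong₂ pair (rename-id-on-names f M (λ p → fix (∈-++⁺ˡ p)))
             (rename-id-on-names f N (λ p → fix (∈-++⁺ʳ (names M) p)))
rename-id-on-names f (senc M N) fix =
  cong₂ senc (rename-id-on-names f M (λ p → fix (∈-++⁺ˡ p)))
             (rename-id-on-names f N (λ p → fix (∈-++⁺ʳ (names M) p)))
rename-id-on-names f (aenc M N) fix =
  cong₂ aenc (rename-id-on-names f M (λ p → fix (∈-++⁺ˡ p)))
             (rename-id-on-names f N (λ p → fix (∈-++⁺ʳ (names M) p)))
rename-id-on-names f (pub K)    fix = cong pub (rename-id-on-names f K fix)

∈-namesSet : ∀ {Γ M a} → M ∈ Γ → a ∈ names M → a ∈ namesSet Γ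
∈-namesSet M∈Γ a∈M = ∈-concatMap⁺ names (lose M∈Γ a∈M)

⊢-weaken : ∀ {Γ Δ M} → Γ ⊆ Δ → Γ ⊢ M → Δ ⊢ M
⊢-weaken Γ⊆Δ (Id p)     = Id (Γ⊆Δ p)
⊢-weaken Γ⊆Δ (Pub d)    = Pub (⊢-weaken Γ⊆Δ d)
⊢-weaken Γ⊆Δ (PL p d)   = PL (Γ⊆Δ p) (⊢-weaken (∷⁺ʳ _ (∷⁺ʳ _ Γ⊆Δ)) d)
⊢-weaken Γ⊆Δ (PR d e)   = PR (⊢-weaken Γ⊆Δ d) (⊢-weaken Γ⊆Δ e)
⊢-weaken Γ⊆Δ (SL p d e) = SL (Γ⊆Δ p) (⊢-weaken Γ⊆Δ d) (⊢-weaken (∷⁺ʳ _ (∷⁺ʳ _ Γ⊆Δ)) e)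
⊢-weaken Γ⊆Δ (SR d e)   = SR (⊢-weaken Γ⊆Δ d) (⊢-weaken Γ⊆Δ e)
⊢-weaken Γ⊆Δ (AL p d e) = AL (Γ⊆Δ p) (⊢-weaken Γ⊆Δ d) (⊢-weaken (∷⁺ʳ _ (∷⁺ʳ _ Γ⊆Δ)) e)
⊢-weaken Γ⊆Δ (AR d e)   = AR (⊢-weaken Γ⊆Δ d) (⊢-weaken Γ⊆Δ e)

⊢-rename : ∀ f {Γ M} → Γ ⊢ M → map (rename f) Γ ⊢ rename f M
⊢-rename f (Id p)     = Id (∈-map⁺ (rename f) p)
⊢-rename f (Pub d)    = Pub (⊢-rename f d)
⊢-rename f (PL p d)   = PL (∈-map⁺ (rename f) p) (⊢-rename f d)
⊢-rename f (PR d e)   = PR (⊢-rename f d) (⊢-rename f e)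
⊢-rename f (SL p d e) = SL (∈-map⁺ (rename f) p) (⊢-rename f d) (⊢-rename f e)
⊢-rename f (SR d e)   = SR (⊢-rename f d) (⊢-rename f e)
⊢-rename f (AL p d e) = AL (∈-map⁺ (rename f) p) (⊢-rename f d) (⊢-rename f e)
⊢-rename f (AR d e)   = AR (⊢-rename f d) (⊢-rename f e)

⊢-transfer : ∀ f {Δ Γ M} → map (rename f) Δ ⊆ Γ → rename f M ≡ M → Δ ⊢ M → Γ ⊢ M
⊢-transfer f fΔ⊆Γ fM≡M d = subst (_ ⊢_) fM≡M (⊢-weaken fΔ⊆Γ (⊢-rename f d))

_↦*_ : ∀ {n} → Vec Name n → Vec Name n → List (Pair Name)
xs ↦* ys = toList (zipWith _↦_ xs ys)

renName-fresh : ∀ {n} (xs ys : Vec Name n) {a} → a ∉ toList xs → renName (xs ↦* ys) a ≡ a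
renName-fresh []       []       a∉xs = refl
renName-fresh (x ∷ xs) (y ∷ ys) {a} a∉xs with x ≟ a
... | yes refl = ⊥-elim (a∉xs (here refl))
... | no _     = renName-fresh xs ys (λ p → a∉xs (there p))

renName-fixes-or-∈ : ∀ {n} (xs ys : Vec Name n) a →
                     renName (xs ↦* ys) a ≡ a ⊎ renName (xs ↦* ys) a ∈ toList ys
renName-fixes-or-∈ []       []       a = inj₁ refl
renName-fixes-or-∈ (x ∷ xs) (y ∷ ys) a with x ≟ a
... | yes _ = inj₂ (here refl)
... | no  _ with renName-fixes-or-∈ xs ys a
...   | inj₁ fixed = inj₁ fixed
...   | inj₂ ∈ys   = inj₂ (there ∈ys)

renName-inverse : ∀ {n} (xs ys : Vec Name n) → Unique ys → ∀ {a} → a ∉ toList ys →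
                  renName (ys ↦* xs) (renName (xs ↦* ys) a) ≡ a
renName-inverse []       []       _            a∉ys = refl
renName-inverse (x ∷ xs) (y ∷ ys) (y∉ys ∷ uys) {a} a∉ys with x ≟ a
... | yes x≡a with y ≟ y
...   | yes _ = x≡a
...   | no y≢y = ⊥-elim (y≢y refl)
renName-inverse (x ∷ xs) (y ∷ ys) (y∉ys ∷ uys) {a} a∉ys | no _
  with y ≟ renName (xs ↦* ys) a
...   | no _ = renName-inverse xs ys uys (λ p → a∉ys (there p))
...   | yes y≡b with renName-fixes-or-∈ xs ys a
...     | inj₁ fixed = ⊥-elim (a∉ys (here (sym (trans y≡b fixed))))
...     | inj₂ ∈ys   = ⊥-elim (All.lookup y∉ys (∈-toList⁻ ∈ys) y≡b)

rename-fresh : ∀ {n} (xs ys : Vec Name n) N → (∀ {a} → a ∈ names N → a ∉ toList xs) →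
               rename (renName (xs ↦* ys)) N ≡ N
rename-fresh xs ys N fresh = rename-id-on-names _ N (λ p → renName-fresh xs ys (fresh p))

rename-inverse : ∀ {n} (xs ys : Vec Name n) → Unique ys → ∀ N → (∀ {a} → a ∈ names N → a ∉ toList ys) →
                 rename (renName (ys ↦* xs)) (renMsg (xs ↦* ys) N) ≡ N
rename-inverse xs ys uniq-ys N fresh = begin
  rename (renName (ys ↦* xs)) (renMsg (xs ↦* ys) N)
    ≡⟨ cong (rename _) (renMsg≡rename (xs ↦* ys) N) ⟩
  rename (renName (ys ↦* xs)) (rename (renName (xs ↦* ys)) N)
    ≡⟨ rename-∘ _ _ N ⟩
  rename (λ a → renName (ys ↦* xs) (renName (xs ↦* ys) a)) N
    ≡⟨ rename-id-on-names _ N (λ p → renName-inverse xs ys uniq-ys (fresh p)) ⟩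
  N ∎
  where open ≡-Reasoning

lemma20 : (n : ℕ) (xs ys : Vec Name n) → Unique xs → Unique ys →
          (Γ : List Msg) → (∀ {y} → y ∈ toList ys → y ∉ namesSet Γ) →
          (M : Msg) → (∀ {a} → a ∈ names M → a ∈ namesSet Γ) →
          ((Γ ++ renSet (toList (zipWith _↦_ xs ys)) Γ) ⊢ M) ⇔ (Γ ⊢ M)
lemma20 n xs ys _ uniq-ys Γ ys∉Γ M M⊆Γ =
  mk⇔ (⊢-transfer (renName (ys ↦* xs)) collapse (rename-fresh ys xs M (λ p q → ys∉Γ q (M⊆Γ p))))
      (⊢-weaken (xs⊆xs++ys Γ _))
  where
  fresh : ∀ {N} → N ∈ Γ → ∀ {a} → a ∈ names N → a ∉ toList ys
  fresh N∈Γ p q = ys∉Γ q (∈-namesSet N∈Γ p)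

  collapse : map (rename (renName (ys ↦* xs))) (Γ ++ renSet (xs ↦* ys) Γ) ⊆ Γ
  collapse p with ∈-map⁻ _ p
  ... | N , N∈ , refl with ∈-++⁻ Γ N∈
  ...   | inj₁ N∈Γ = subst (_∈ Γ) (sym (rename-fresh ys xs N (fresh N∈Γ))) N∈Γ
  ...   | inj₂ N∈Γ′ with ∈-map⁻ _ N∈Γ′
  ...     | L , L∈Γ , refl = subst (_∈ Γ) (sym (rename-inverse xs ys uniq-ys L (fresh L∈Γ))) L∈Γ
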